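{- Let $p\ge 3$ be a prime. There is no surjective quadratic cellular automaton over $\mathbb{Z}_p$; that is, if $F$ is a one-dimensional cellular automaton over $\mathbb{Z}_p$ with diameter $d$ whose local rule $f:\mathbb{Z}_p^{d+1}\to\mathbb{Z}_p$ is a quadratic form, then $F$ is not surjective.
   Context: A cellular automaton (CA) over the finite alphabet $A=\mathbb{Z}_m$ is a map $F:A^{\mathbb{Z}}\to A^{\mathbb{Z}}$ for which there are an integer radius $\rho\ge 0$ and a local rule $f:A^{2\rho+1}\to A$ with $F(x)_i=f(x_{i-\rho},\dots,x_{i+\rho})$ for all $x\in A^{\mathbb{Z}}$ and $i\in\mathbb{Z}$; $d=2\rho$ is the diameter. The local rule $f:\mathbb{Z}_m^{d+1}\to\mathbb{Z}_m$ is a quadratic form if $f(au)=a^2f(u)$ for all $u\in\mathbb{Z}_m^{d+1}$, $a\in\mathbb{Z}_m$, and the map $(u,v)\mapsto f(u+v)-f(u)-f(v)$ is bilinear. $F$ is surjective if it is onto. -}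

module Defs where

open import Data.Nat as ℕ using (ℕ; zero; suc; NonZero)
open import Data.Nat.DivMod using (_mod_)
open import Data.Fin using (Fin; toℕ)
open import Data.Integer as ℤ using (ℤ)
open import Data.Vec using (Vec; tabulate; map; zipWith)
open import Data.Product using (Σ; ∃)
open import Relation.Binary.PropositionalEquality using (_≡_)
open import Relation.Nullary using (¬_)

module ZMod (m : ℕ) .{{_ : NonZero m}} where

  Zm : Set
  Zm = Fin m

  infixl 6 _+ₘ_ _-ₘ_
  infixl 7 _*ₘ_

  _+ₘ_ : Zm → Zm → Zm
  a +ₘ b = (toℕ a ℕ.+ toℕ b) mod m

  _*ₘ_ : Zm → Zm → Zm
  a *ₘ b = (toℕ a ℕ.* toℕ b) mod m

  _-ₘ_ : Zm → Zm → Zm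
  a -ₘ b = (toℕ a ℕ.+ (m ℕ.∸ toℕ b)) mod m

  _⊕_ : ∀ {n} → Vec Zm n → Vec Zm n → Vec Zm n
  u ⊕ v = zipWith _+ₘ_ u v

  _·_ : ∀ {n} → Zm → Vec Zm n → Vec Zm n
  a · u = map (a *ₘ_) u

  polar : ∀ {n} → (Vec Zm n → Zm) → Vec Zm n → Vec Zm n → Zm
  polar f u v = f (u ⊕ v) -ₘ f u -ₘ f v

  record IsBilinear {n : ℕ} (B : Vec Zm n → Vec Zm n → Zm) : Set where
    field
      additiveˡ : ∀ u v w → B (u ⊕ v) w ≡ B u w +ₘ B v w
      homogeneousˡ : ∀ a u w → B (a · u) w ≡ a *ₘ B u w
      additiveʳ : ∀ u v w → B u (v ⊕ w) ≡ B u v +ₘ B u w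
      homogeneousʳ : ∀ a u v → B u (a · v) ≡ a *ₘ B u v

  record IsQuadraticForm {n : ℕ} (f : Vec Zm n → Zm) : Set where
    field
      homogeneous2 : ∀ a u → f (a · u) ≡ (a *ₘ a) *ₘ f u
      polarBilinear : IsBilinear (polar f)

Config : Set → Set
Config A = ℤ → A

-- The cellular automaton of radius ρ (diameter d = 2ρ) with local rule
-- f : A^(d+1) → A:  F(x)_i = f(x_{i-ρ}, …, x_{i+ρ}).
CA : {A : Set} (ρ : ℕ) → (Vec A (suc (ρ ℕ.+ ρ)) → A) → Config A → Config A
CA ρ f x i = f (tabulate (λ (j : Fin (suc (ρ ℕ.+ ρ))) → x ((i ℤ.- ℤ.+ ρ) ℤ.+ ℤ.+ (toℕ j))))

Surjective : {A : Set} → (Config A → Config A) → Set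
Surjective {A} F = ∀ (y : Config A) → ∃ λ (x : Config A) → ∀ i → F x i ≡ y i

-- Only f (−u) = f u, f 0 = 0 and the oddness of p are used. Surjectivity forces every
-- symbol c to have at least p ^ d preimages under f: a configuration whose image reads
-- c, w₁, c, w₂, …, c for arbitrary words wᵢ of length d splits, on the relevant cells,
-- into k + 1 blocks of length d + 1 that f sends to c, so p ^ (k d) ≤ N(c) ^ (k + 1) for
-- every k, whence p ^ d ≤ N(c). The N(c) add up to p ^ (d + 1), so they all equal p ^ d,
-- an odd number; yet u ↦ −u pairs off the preimages of 1, as its only fixed point 0 is
-- sent to 0.
module Submission where

open import Defs
open import Data.Nat using (ℕ; zero; suc; _+_; _*_; _^_; _∸_; _%_; _≤_; _<_; _≥_; z≤n; s≤s; z<s; NonZero)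
open import Data.Nat.Properties hiding (0≢1+n)
open import Data.Nat.DivMod using (m<n⇒m%n≡m; [m+kn]%n≡m%n)
open import Data.Nat.Divisibility using (divides)
open import Data.Nat.Primality using (Prime; composite; prime⇒¬composite)
open import Data.Nat.Solver using (module +-*-Solver)
open import Data.Fin using (Fin; zero; suc; toℕ; inject₁; opposite)
open import Data.Fin.Properties using (toℕ-injective; toℕ-fromℕ; toℕ-fromℕ<; toℕ<n; opposite-prop; opposite-involutive; 0≢1+n)
open import Data.Fin.Permutation using (permutation)
open import Data.Vec using (Vec; []; _∷_; _++_; take; drop; map; replicate; tabulate)
open import Data.Vec.Properties using (take++drop≡id; tabulate-cong; map-cong; map-replicate)
import Data.Integer as ℤ
import Data.Integer.Properties as ℤP
open import Data.Product using (∃; _×_; _,_; proj₁; proj₂)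
open import Data.Sum using (_⊎_; inj₁; inj₂)
open import Function using (_∘_)
open import Relation.Binary.PropositionalEquality
open import Relation.Nullary using (¬_; contradiction)
open import Algebra.Properties.Semiring.Sum +-*-semiring using (sum; sum-syntax; sum-cong-≗; sum-replicate-zero; ∑-comm; *-distribˡ-sum; *-distribʳ-sum; sum-init-last; sum-permute)
open +-*-Solver using (solve; _:+_; _:*_; _:=_; con)

sum-const : ∀ n c → ∑[ i < n ] c ≡ n * c
sum-const zero    c = refl
sum-const (suc n) c = cong (c +_) (sum-const n c)

sum-mono-≤ : ∀ {n} {g h : Fin n → ℕ} → (∀ i → g i ≤ h i) → sum g ≤ sum h
sum-mono-≤ {zero}  g≤h = z≤n
sum-mono-≤ {suc n} g≤h = +-mono-≤ (g≤h zero) (sum-mono-≤ (g≤h ∘ suc))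

sum-mono-< : ∀ {n} {g h : Fin n → ℕ} (j : Fin n) → (∀ i → g i ≤ h i) → g j < h j → sum g < sum h
sum-mono-< zero    g≤h gj<hj = +-mono-<-≤ gj<hj (sum-mono-≤ (g≤h ∘ suc))
sum-mono-< (suc j) g≤h gj<hj = +-mono-≤-< (g≤h zero) (sum-mono-< j (g≤h ∘ suc) gj<hj)

term≤sum : ∀ {n} (g : Fin n → ℕ) i → g i ≤ sum g
term≤sum g zero    = m≤m+n _ _
term≤sum g (suc i) = ≤-trans (term≤sum (g ∘ suc) i) (m≤n+m _ _)

δ : ∀ {k} → Fin k → Fin k → ℕ
δ zero    zero    = 1
δ zero    (suc _) = 0
δ (suc _) zero    = 0
δ (suc a) (suc b) = δ a b

δ-refl : ∀ {k} (a : Fin k) → δ a a ≡ 1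
δ-refl zero    = refl
δ-refl (suc a) = δ-refl a

δ-≢ : ∀ {k} {a b : Fin k} → a ≢ b → δ a b ≡ 0
δ-≢ {a = zero}  {zero}  a≢b = contradiction refl a≢b
δ-≢ {a = zero}  {suc b} a≢b = refl
δ-≢ {a = suc a} {zero}  a≢b = refl
δ-≢ {a = suc a} {suc b} a≢b = δ-≢ (a≢b ∘ cong suc)

sum-δ : ∀ {k} (a : Fin k) → ∑[ b < k ] δ a b ≡ 1
sum-δ {suc k} zero    = cong suc (sum-replicate-zero k)
sum-δ {suc k} (suc a) = sum-δ a

∑ⱽ : ∀ {k} n → (Vec (Fin k) n → ℕ) → ℕ
∑ⱽ         zero    h = h []
∑ⱽ {k = k} (suc n) h = ∑[ a < k ] ∑ⱽ n (λ v → h (a ∷ v))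

module _ {k : ℕ} where

  ∑ⱽ-cong : ∀ n {g h : Vec (Fin k) n → ℕ} → (∀ v → g v ≡ h v) → ∑ⱽ n g ≡ ∑ⱽ n h
  ∑ⱽ-cong zero    g≗h = g≗h []
  ∑ⱽ-cong (suc n) g≗h = sum-cong-≗ {k} (λ a → ∑ⱽ-cong n (g≗h ∘ (a ∷_)))

  ∑ⱽ-mono-≤ : ∀ n {g h : Vec (Fin k) n → ℕ} → (∀ v → g v ≤ h v) → ∑ⱽ n g ≤ ∑ⱽ n h
  ∑ⱽ-mono-≤ zero    g≤h = g≤h []
  ∑ⱽ-mono-≤ (suc n) g≤h = sum-mono-≤ (λ a → ∑ⱽ-mono-≤ n (g≤h ∘ (a ∷_)))

  ∑ⱽ-*ˡ : ∀ n c (h : Vec (Fin k) n → ℕ) → ∑ⱽ n (λ v → c * h v) ≡ c * ∑ⱽ n h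
  ∑ⱽ-*ˡ zero    c h = refl
  ∑ⱽ-*ˡ (suc n) c h = trans (sum-cong-≗ {k} (λ a → ∑ⱽ-*ˡ n c _)) (sym (*-distribˡ-sum c (λ a → ∑ⱽ n (h ∘ (a ∷_)))))

  ∑ⱽ-const : ∀ n c → ∑ⱽ {k} n (λ _ → c) ≡ k ^ n * c
  ∑ⱽ-const zero    c = sym (+-identityʳ c)
  ∑ⱽ-const (suc n) c = begin
    ∑[ a < k ] ∑ⱽ n (λ _ → c) ≡⟨ sum-cong-≗ {k} (λ _ → ∑ⱽ-const n c) ⟩
    ∑[ a < k ] (k ^ n * c)    ≡⟨ sum-const k _ ⟩
    k * (k ^ n * c)           ≡⟨ *-assoc k (k ^ n) c ⟨
    k ^ suc n * c             ∎
    where open ≡-Reasoning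

  term≤∑ⱽ : ∀ n (h : Vec (Fin k) n → ℕ) v → h v ≤ ∑ⱽ n h
  term≤∑ⱽ zero    h []      = ≤-refl
  term≤∑ⱽ (suc n) h (a ∷ v) =
    ≤-trans (term≤∑ⱽ n (h ∘ (a ∷_)) v) (term≤sum (λ b → ∑ⱽ n (h ∘ (b ∷_))) a)

  sum-∑ⱽ-comm : ∀ m n (h : Fin m → Vec (Fin k) n → ℕ) →
                ∑[ i < m ] ∑ⱽ n (h i) ≡ ∑ⱽ n (λ v → ∑[ i < m ] h i v)
  sum-∑ⱽ-comm m zero    h = refl
  sum-∑ⱽ-comm m (suc n) h = trans (∑-comm (λ i a → ∑ⱽ n (h i ∘ (a ∷_))))
    (sum-cong-≗ {k} (λ a → sum-∑ⱽ-comm m n (λ i → h i ∘ (a ∷_))))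

  ∑ⱽ-comm : ∀ m n (h : Vec (Fin k) m → Vec (Fin k) n → ℕ) →
            ∑ⱽ m (λ y → ∑ⱽ n (h y)) ≡ ∑ⱽ n (λ x → ∑ⱽ m (λ y → h y x))
  ∑ⱽ-comm zero    n h = refl
  ∑ⱽ-comm (suc m) n h = trans (sum-cong-≗ {k} (λ a → ∑ⱽ-comm m n (h ∘ (a ∷_))))
    (sum-∑ⱽ-comm k n (λ a x → ∑ⱽ m (λ y → h (a ∷ y) x)))

  ∑ⱽ-split : ∀ m n (g : Vec (Fin k) m → ℕ) (h : Vec (Fin k) n → ℕ) →
             ∑ⱽ (m + n) (λ x → g (take m x) * h (drop m x)) ≡ ∑ⱽ m g * ∑ⱽ n h
  ∑ⱽ-split zero    n g h = ∑ⱽ-*ˡ n (g []) h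
  ∑ⱽ-split (suc m) n g h = trans (sum-cong-≗ {k} (λ a → ∑ⱽ-split m n (g ∘ (a ∷_)) h))
    (sym (*-distribʳ-sum (∑ⱽ n h) (λ a → ∑ⱽ m (g ∘ (a ∷_)))))

  δⱽ : ∀ {n} → Vec (Fin k) n → Vec (Fin k) n → ℕ
  δⱽ []      []      = 1
  δⱽ (a ∷ u) (b ∷ v) = δ a b * δⱽ u v

  δⱽ-refl : ∀ {n} (u : Vec (Fin k) n) → δⱽ u u ≡ 1
  δⱽ-refl []      = refl
  δⱽ-refl (a ∷ u) = cong₂ _*_ (δ-refl a) (δⱽ-refl u)

  ∑ⱽ-δⱽ : ∀ n (u : Vec (Fin k) n) → ∑ⱽ n (δⱽ u) ≡ 1
  ∑ⱽ-δⱽ zero    []      = refl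
  ∑ⱽ-δⱽ (suc n) (a ∷ u) = begin
    ∑[ b < k ] ∑ⱽ n (λ v → δ a b * δⱽ u v) ≡⟨ sum-cong-≗ {k} (λ b → ∑ⱽ-*ˡ n (δ a b) (δⱽ u)) ⟩
    ∑[ b < k ] (δ a b * ∑ⱽ n (δⱽ u))       ≡⟨ sum-cong-≗ {k} (λ b → cong (δ a b *_) (∑ⱽ-δⱽ n u)) ⟩
    ∑[ b < k ] (δ a b * 1)                 ≡⟨ sum-cong-≗ {k} (λ b → *-identityʳ (δ a b)) ⟩
    ∑[ b < k ] δ a b                       ≡⟨ sum-δ a ⟩
    1                                      ∎
    where open ≡-Reasoning

  fibre-onto⇒≥ : ∀ {l m n} (B : Vec (Fin k) n → Vec (Fin k) l) (b : Vec (Fin k) l)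
                 (G : Vec (Fin k) n → Vec (Fin k) m) →
                 (∀ y → ∃ λ x → B x ≡ b × G x ≡ y) →
                 k ^ m ≤ ∑ⱽ n (λ x → δⱽ (B x) b)
  fibre-onto⇒≥ {m = m} {n} B b G onto = begin
    k ^ m                                    ≡⟨ *-identityʳ (k ^ m) ⟨
    k ^ m * 1                                ≡⟨ ∑ⱽ-const m 1 ⟨
    ∑ⱽ m (λ _ → 1)                           ≤⟨ ∑ⱽ-mono-≤ m hit ⟩
    ∑ⱽ m (λ y → ∑ⱽ n (λ x → w x * δⱽ (G x) y)) ≡⟨ ∑ⱽ-comm m n _ ⟩
    ∑ⱽ n (λ x → ∑ⱽ m (λ y → w x * δⱽ (G x) y)) ≡⟨ ∑ⱽ-cong n weight ⟩
    ∑ⱽ n w                                   ∎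
    where
    open ≤-Reasoning
    w : Vec (Fin k) n → ℕ
    w x = δⱽ (B x) b

    weight : ∀ x → ∑ⱽ m (λ y → w x * δⱽ (G x) y) ≡ w x
    weight x = trans (∑ⱽ-*ˡ m (w x) _) (trans (cong (w x *_) (∑ⱽ-δⱽ m (G x))) (*-identityʳ (w x)))

    hit : ∀ y → 1 ≤ ∑ⱽ n (λ x → w x * δⱽ (G x) y)
    hit y with onto y
    ... | x , Bx≡b , Gx≡y = ≤-trans
      (≤-reflexive (sym (cong₂ _*_ (subst (λ v → δⱽ (B x) v ≡ 1) Bx≡b (δⱽ-refl (B x)))
                                   (subst (λ v → δⱽ (G x) v ≡ 1) Gx≡y (δⱽ-refl (G x))))))
      (term≤∑ⱽ n _ x)

^≤^-suc⇒≤ : ∀ {q n} → (∀ k → q ^ k ≤ n ^ suc k) → q ≤ n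
^≤^-suc⇒≤ {q} {n} bound = ≮⇒≥ (λ n<q → suc-^≰^-suc n (λ k → ≤-trans (^-monoˡ-≤ k n<q) (bound k)))
  where
  bernoulli : ∀ r K → r ^ K * (r + K) ≤ suc r ^ K * r
  bernoulli r zero    = ≤-reflexive (+-identityʳ (r + 0))
  bernoulli r (suc K) = begin
    r * a * (r + suc K)       ≡⟨ solve 3 (λ r a K → r :* a :* (r :+ (con 1 :+ K)) := r :* (a :* (r :+ K)) :+ r :* a) refl r a K ⟩
    r * (a * (r + K)) + r * a ≤⟨ +-mono-≤ (*-monoʳ-≤ r (bernoulli r K)) (*-monoʳ-≤ r (^-monoˡ-≤ K (n≤1+n r))) ⟩
    r * (b * r) + r * b       ≡⟨ solve 2 (λ r b → r :* (b :* r) :+ r :* b := (con 1 :+ r) :* b :* r) refl r b ⟩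
    suc r * b * r             ∎
    where
    open ≤-Reasoning
    a = r ^ K
    b = suc r ^ K

  -- Bernoulli at K = r * r: r * (r + 1) ^ K ≥ r ^ K * (r + r * r) > r * r ^ (K + 1).
  suc-^≰^-suc : ∀ r → ¬ (∀ k → suc r ^ k ≤ r ^ suc k)
  suc-^≰^-suc zero       bound′ = contradiction (bound′ 0) λ ()
  suc-^≰^-suc r@(suc _) bound′ = <⇒≱ (m<n+m K z<s) (*-cancelˡ-≤ (r ^ K) {{m^n≢0 r K}} (begin
    r ^ K * (r + K) ≤⟨ bernoulli r K ⟩
    suc r ^ K * r   ≤⟨ *-monoˡ-≤ r (bound′ K) ⟩
    r ^ suc K * r   ≡⟨ solve 2 (λ r a → r :* a :* r := a :* (r :* r)) refl r (r ^ K) ⟩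
    r ^ K * K       ∎))
    where
    open ≤-Reasoning
    K = r * r

module _ {A : Set} where

  prefix : (ℕ → A) → ∀ n → Vec A n
  prefix X n = tabulate (X ∘ toℕ)

  shift : ℕ → (ℕ → A) → ℕ → A
  shift m X t = X (m + t)

  infixr 5 _++ˢ_
  _++ˢ_ : ∀ {n} → Vec A n → (ℕ → A) → ℕ → A
  ([]      ++ˢ Z) t       = Z t
  ((a ∷ v) ++ˢ Z) zero    = a
  ((a ∷ v) ++ˢ Z) (suc t) = (v ++ˢ Z) t

  prefix-cong : ∀ n {X Y : ℕ → A} → (∀ t → t < n → X t ≡ Y t) → prefix X n ≡ prefix Y n
  prefix-cong n X≈Y = tabulate-cong (λ i → X≈Y (toℕ i) (toℕ<n i))

  take-prefix : ∀ m n (X : ℕ → A) → take m (prefix X (m + n)) ≡ prefix X m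
  take-prefix zero    n X = refl
  take-prefix (suc m) n X = cong (X 0 ∷_) (take-prefix m n (X ∘ suc))

  drop-prefix : ∀ m n (X : ℕ → A) → drop m (prefix X (m + n)) ≡ prefix (shift m X) n
  drop-prefix zero    n X = refl
  drop-prefix (suc m) n X = drop-prefix m n (X ∘ suc)

  prefix-++ˢ : ∀ {n} (v : Vec A n) Z → prefix (v ++ˢ Z) n ≡ v
  prefix-++ˢ []      Z = refl
  prefix-++ˢ (a ∷ v) Z = cong (a ∷_) (prefix-++ˢ v Z)

  ++ˢ-+ : ∀ {m} (v : Vec A m) Z t → (v ++ˢ Z) (m + t) ≡ Z t
  ++ˢ-+ []      Z t = refl
  ++ˢ-+ (a ∷ v) Z t = ++ˢ-+ v Z t

  prefix-++ˢ-< : ∀ n X Z t → t < n → (prefix X n ++ˢ Z) t ≡ X t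
  prefix-++ˢ-< (suc n) X Z zero    t<n       = refl
  prefix-++ˢ-< (suc n) X Z (suc t) (s≤s t<n) = prefix-++ˢ-< n (X ∘ suc) Z t t<n

-- CA ρ f read on the cells ρ, ρ + 1, …, so that the window of cell t starts at t.
slide : ∀ {A : Set} {d} → (Vec A (suc d) → A) → (ℕ → A) → ℕ → A
slide {d = d} f X t = f (prefix (shift t X) (suc d))

SlideSurjective : ∀ {A : Set} {d} → (Vec A (suc d) → A) → Set
SlideSurjective {A} f = ∀ (Y : ℕ → A) → ∃ λ X → ∀ t → slide f X t ≡ Y t

module _ {A : Set} {d} (f : Vec A (suc d) → A) where

  slide-shift : ∀ m X t → slide f (shift m X) t ≡ slide f X (m + t)
  slide-shift m X t = cong f (prefix-cong (suc d) (λ s _ → cong X (sym (+-assoc m t s))))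

  slide-++ˢ : ∀ n X Z t → t + suc d ≤ n → slide f (prefix X n ++ˢ Z) t ≡ slide f X t
  slide-++ˢ n X Z t t+D≤n = cong f (prefix-cong (suc d)
    (λ s s<D → prefix-++ˢ-< n X Z (t + s) (≤-trans (+-monoʳ-< t s<D) t+D≤n)))

-- marked k g outputs c at the cells 0, D, …, k D (D = d + 1) and the word g in the gaps.
module Blocks {A : Set} {d} (f : Vec A (suc d) → A) (c : A) where

  D : ℕ
  D = suc d

  marked : ∀ k → Vec A (k * d) → ℕ → A
  marked zero    _ _ = c
  marked (suc k) g   = (c ∷ take d g) ++ˢ marked k (drop d g)

  blockValues : ∀ j → Vec A (j * D) → Vec A j
  blockValues zero    _ = []
  blockValues (suc j) x = f (take D x) ∷ blockValues j (drop D x)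

  -- The padding by c is immaterial: each gap only reads the two blocks around it.
  gaps : ∀ k → Vec A (suc k * D) → Vec A (k * d)
  gaps zero    _ = []
  gaps (suc k) x = prefix (slide f (x ++ˢ λ _ → c) ∘ suc) d ++ gaps k (drop D x)

  marked-zero : ∀ k g → marked k g 0 ≡ c
  marked-zero zero    g = refl
  marked-zero (suc k) g = refl

  firstBlock-marked : ∀ k X g → (∀ t → slide f X t ≡ marked k g t) →
                      ∀ n → f (take D (prefix X (D + n))) ≡ c
  firstBlock-marked k X g slide≡marked n =
    trans (cong f (take-prefix D n X)) (trans (slide≡marked 0) (marked-zero k g))

  marked-shift : ∀ k X g → (∀ t → slide f X t ≡ marked (suc k) g t) →
                 ∀ t → slide f (shift D X) t ≡ marked k (drop d g) t
  marked-shift k X g slide≡marked t =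
    trans (slide-shift f D X t) (trans (slide≡marked (D + t)) (++ˢ-+ (c ∷ take d g) _ t))

  blockValues-marked : ∀ k X g → (∀ t → slide f X t ≡ marked k g t) →
                       blockValues (suc k) (prefix X (suc k * D)) ≡ replicate (suc k) c
  blockValues-marked zero    X g slide≡marked =
    cong (_∷ []) (firstBlock-marked zero X g slide≡marked 0)
  blockValues-marked (suc k) X g slide≡marked = cong₂ _∷_ (firstBlock-marked (suc k) X g slide≡marked _)
    (trans (cong (blockValues (suc k)) (drop-prefix D _ X))
           (blockValues-marked k (shift D X) (drop d g) (marked-shift k X g slide≡marked)))

  gaps-marked : ∀ k X g → (∀ t → slide f X t ≡ marked k g t) → gaps k (prefix X (suc k * D)) ≡ g
  gaps-marked zero    X [] slide≡marked = refl
  gaps-marked (suc k) X g  slide≡marked = begin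
    prefix (slide f (x ++ˢ λ _ → c) ∘ suc) d ++ gaps k (drop D x) ≡⟨ cong₂ _++_ firstGap restGaps ⟩
    take d g ++ drop d g                                          ≡⟨ take++drop≡id d g ⟩
    g                                                             ∎
    where
    open ≡-Reasoning
    x : Vec A (suc (suc k) * D)
    x = prefix X (suc (suc k) * D)

    window-inside : ∀ t → t < d → suc t + D ≤ suc (suc k) * D
    window-inside t t<d = ≤-trans (+-monoˡ-≤ D (m≤n⇒m≤1+n t<d)) (+-monoʳ-≤ D (m≤m+n D (k * D)))

    gap-marked : ∀ t → t < d → slide f (x ++ˢ λ _ → c) (suc t) ≡ marked (suc k) g (suc t)
    gap-marked t t<d = trans (slide-++ˢ f _ X _ (suc t) (window-inside t t<d)) (slide≡marked (suc t))

    firstGap : prefix (slide f (x ++ˢ λ _ → c) ∘ suc) d ≡ take d g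
    firstGap = begin
      prefix (slide f (x ++ˢ λ _ → c) ∘ suc) d    ≡⟨ prefix-cong d gap-marked ⟩
      prefix (take d g ++ˢ marked k (drop d g)) d ≡⟨ prefix-++ˢ (take d g) _ ⟩
      take d g                                    ∎

    restGaps : gaps k (drop D x) ≡ drop d g
    restGaps = trans (cong (gaps k) (drop-prefix D _ X))
                     (gaps-marked k (shift D X) (drop d g) (marked-shift k X g slide≡marked))

fibreCount : ∀ {k d} → (Vec (Fin k) (suc d) → Fin k) → Fin k → ℕ
fibreCount {d = d} f c = ∑ⱽ (suc d) (λ u → δ (f u) c)

module _ {k d} (f : Vec (Fin k) (suc d) → Fin k) where

  ∑-fibreCount : ∑[ c < k ] fibreCount f c ≡ k ^ suc d
  ∑-fibreCount = begin
    ∑[ c < k ] ∑ⱽ (suc d) (λ u → δ (f u) c) ≡⟨ sum-∑ⱽ-comm k (suc d) (λ c u → δ (f u) c) ⟩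
    ∑ⱽ (suc d) (λ u → ∑[ c < k ] δ (f u) c) ≡⟨ ∑ⱽ-cong (suc d) (λ u → sum-δ (f u)) ⟩
    ∑ⱽ {k} (suc d) (λ _ → 1)               ≡⟨ ∑ⱽ-const {k} (suc d) 1 ⟩
    k ^ suc d * 1                          ≡⟨ *-identityʳ (k ^ suc d) ⟩
    k ^ suc d                              ∎
    where open ≡-Reasoning

  module _ (c : Fin k) where
    open Blocks f c

    ∑ⱽ-blockValues : ∀ j → ∑ⱽ (j * D) (λ x → δⱽ (blockValues j x) (replicate j c)) ≡ fibreCount f c ^ j
    ∑ⱽ-blockValues zero    = refl
    ∑ⱽ-blockValues (suc j) = trans
      (∑ⱽ-split D (j * D) (λ u → δ (f u) c) (λ x → δⱽ (blockValues j x) (replicate j c)))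
      (cong (fibreCount f c *_) (∑ⱽ-blockValues j))

    slideSurjective⇒fibreCount≥ : SlideSurjective f → k ^ d ≤ fibreCount f c
    slideSurjective⇒fibreCount≥ surj = ^≤^-suc⇒≤ λ j → begin
      (k ^ d) ^ j                                 ≡⟨ ^-*-assoc k d j ⟩
      k ^ (d * j)                                 ≡⟨ cong (k ^_) (*-comm d j) ⟩
      k ^ (j * d)
        ≤⟨ fibre-onto⇒≥ (blockValues (suc j)) (replicate (suc j) c) (gaps j) (onto j) ⟩
      ∑ⱽ (suc j * D) (λ x → δⱽ (blockValues (suc j) x) (replicate (suc j) c))
        ≡⟨ ∑ⱽ-blockValues (suc j) ⟩
      fibreCount f c ^ suc j                      ∎
      where
      open ≤-Reasoning
      onto : ∀ j (g : Vec (Fin k) (j * d)) →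
             ∃ λ x → blockValues (suc j) x ≡ replicate (suc j) c × gaps j x ≡ g
      onto j g with surj (marked j g)
      ... | X , slide≡marked =
        prefix X (suc j * D) , blockValues-marked j X g slide≡marked , gaps-marked j X g slide≡marked

-- Negation in ℤ_(n+1): −(i + 1) = n − i.
mirror : ∀ {n} → Fin (suc n) → Fin (suc n)
mirror zero    = zero
mirror (suc i) = suc (opposite i)

mirror-involutive : ∀ {n} (a : Fin (suc n)) → mirror (mirror a) ≡ a
mirror-involutive zero    = refl
mirror-involutive (suc i) = cong suc (opposite-involutive i)

sum-mirror : ∀ {n} (g : Fin (suc n) → ℕ) → ∑[ a < suc n ] g (mirror a) ≡ sum g
sum-mirror g = sym (sum-permute g (permutation mirror mirror mirror-involutive mirror-involutive))

opposite-inject₁ : ∀ {n} (i : Fin n) → opposite (inject₁ i) ≡ suc (opposite i)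
opposite-inject₁ {suc n} zero    = refl
opposite-inject₁ {suc n} (suc i) = cong inject₁ (opposite-inject₁ i)

sum-opposite-even : ∀ r (g : Fin (r * 2) → ℕ) → (∀ i → g (opposite i) ≡ g i) → ∃ λ t → sum g ≡ t * 2
sum-opposite-even zero    g g-sym = 0 , refl
sum-opposite-even (suc r) g g-sym with sum-opposite-even r (g ∘ suc ∘ inject₁) inner-sym
  where
  inner-sym : ∀ i → g (suc (inject₁ (opposite i))) ≡ g (suc (inject₁ i))
  inner-sym i = trans (cong (g ∘ inject₁) (sym (opposite-inject₁ i))) (g-sym (suc (inject₁ i)))
... | t , inner≡ = g zero + t , (begin
  g zero + sum (g ∘ suc)                                 ≡⟨ cong (g zero +_) (sum-init-last (g ∘ suc)) ⟩
  g zero + (sum (g ∘ suc ∘ inject₁) + g (opposite zero)) ≡⟨ cong₂ (λ s e → g zero + (s + e)) inner≡ (g-sym zero) ⟩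
  g zero + (t * 2 + g zero)                              ≡⟨ solve 2 (λ a t → a :+ (t :* con 2 :+ a) := (a :+ t) :* con 2) refl (g zero) t ⟩
  (g zero + t) * 2                                       ∎)
  where open ≡-Reasoning

∑ⱽ-mirror : ∀ {k} n (h : Vec (Fin (suc k)) n → ℕ) → ∑ⱽ n (h ∘ map mirror) ≡ ∑ⱽ n h
∑ⱽ-mirror zero    h = refl
∑ⱽ-mirror (suc n) h = trans (sum-cong-≗ (λ a → ∑ⱽ-mirror n (h ∘ (mirror a ∷_))))
                            (sum-mirror (λ a → ∑ⱽ n (h ∘ (a ∷_))))

∑ⱽ-mirror-even : ∀ r n (h : Vec (Fin (suc (r * 2))) n → ℕ) → (∀ v → h (map mirror v) ≡ h v) →
                 ∃ λ t → ∑ⱽ n h ≡ h (replicate n zero) + t * 2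
∑ⱽ-mirror-even r zero    h h-sym = 0 , sym (+-identityʳ (h []))
∑ⱽ-mirror-even r (suc n) h h-sym
  with ∑ⱽ-mirror-even r n (h ∘ (zero ∷_)) (λ v → h-sym (zero ∷ v))
     | sum-opposite-even r (column ∘ suc) (λ i → column-mirror (suc i))
  where
  column : Fin (suc (r * 2)) → ℕ
  column a = ∑ⱽ n (h ∘ (a ∷_))

  column-mirror : ∀ a → column (mirror a) ≡ column a
  column-mirror a = trans (sym (∑ⱽ-mirror n (h ∘ (mirror a ∷_))))
                            (∑ⱽ-cong n (λ v → h-sym (a ∷ v)))
... | t₀ , e₀ | t₁ , e₁ = t₀ + t₁ , trans (cong₂ _+_ e₀ e₁)
  (solve 3 (λ a t₀ t₁ → a :+ t₀ :* con 2 :+ t₁ :* con 2 := a :+ (t₀ :+ t₁) :* con 2)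
           refl (h (replicate (suc n) zero)) t₀ t₁)

module _ (n : ℕ) where
  open ZMod (suc (suc n))

  -1ₘ : Zm
  -1ₘ = mirror (suc zero)

  -1ₘ*ₘ≡mirror : ∀ a → -1ₘ *ₘ a ≡ mirror a
  -1ₘ*ₘ≡mirror zero    = toℕ-injective (trans (toℕ-fromℕ< _) (cong (_% suc (suc n)) (*-zeroʳ (toℕ -1ₘ))))
  -1ₘ*ₘ≡mirror (suc i) = toℕ-injective (begin
    toℕ (-1ₘ *ₘ suc i)         ≡⟨ toℕ-fromℕ< _ ⟩
    (toℕ -1ₘ * suc j) % p      ≡⟨ cong (λ m → (m * suc j) % p) (cong suc (toℕ-fromℕ n)) ⟩
    (m * suc j) % p            ≡⟨ cong (_% p) m*[1+j]≡[m∸j]+j*p ⟩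
    ((m ∸ j) + j * p) % p      ≡⟨ [m+kn]%n≡m%n (m ∸ j) j p ⟩
    (m ∸ j) % p                ≡⟨ m<n⇒m%n≡m (s≤s (m∸n≤m m j)) ⟩
    m ∸ j                      ≡⟨ +-∸-assoc 1 (toℕ<n i) ⟩
    suc (m ∸ suc j)            ≡⟨ cong suc (opposite-prop i) ⟨
    toℕ (mirror (suc i))       ∎)
    where
    open ≡-Reasoning
    j m p : ℕ
    j = toℕ i
    m = suc n
    p = suc m
    m*[1+j]≡[m∸j]+j*p : m * suc j ≡ (m ∸ j) + j * p
    m*[1+j]≡[m∸j]+j*p = begin
      m * suc j               ≡⟨ *-suc m j ⟩
      m + m * j               ≡⟨ cong₂ _+_ (m∸n+n≡m (<⇒≤ (toℕ<n i))) (*-comm j m) ⟨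
      (m ∸ j) + j + j * m     ≡⟨ +-assoc (m ∸ j) j (j * m) ⟩
      (m ∸ j) + (j + j * m)   ≡⟨ cong ((m ∸ j) +_) (*-suc j m) ⟨
      (m ∸ j) + j * p         ∎

  1ₘ*ₘ : ∀ a → suc zero *ₘ a ≡ a
  1ₘ*ₘ a = toℕ-injective (trans (toℕ-fromℕ< _)
    (trans (cong (_% suc (suc n)) (*-identityˡ (toℕ a))) (m<n⇒m%n≡m (toℕ<n a))))

  module _ {l} {f : Vec Zm l → Zm} (quadratic : IsQuadraticForm f) where
    open IsQuadraticForm quadratic

    quadratic-mirror : ∀ u → f (map mirror u) ≡ f u
    quadratic-mirror u = begin
      f (map mirror u)       ≡⟨ cong f (map-cong -1ₘ*ₘ≡mirror u) ⟨
      f (-1ₘ · u)            ≡⟨ homogeneous2 -1ₘ u ⟩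
      (-1ₘ *ₘ -1ₘ) *ₘ f u    ≡⟨ cong (_*ₘ f u) (trans (-1ₘ*ₘ≡mirror -1ₘ) (mirror-involutive (suc zero))) ⟩
      suc zero *ₘ f u        ≡⟨ 1ₘ*ₘ (f u) ⟩
      f u                    ∎
      where open ≡-Reasoning

    quadratic-zero : f (replicate l zero) ≡ zero
    quadratic-zero = trans (cong f (sym (map-replicate (zero *ₘ_) zero l))) (homogeneous2 zero (replicate l zero))

CA-surjective⇒slideSurjective : ∀ {A : Set} ρ (f : Vec A (suc (ρ + ρ)) → A) →
                                Surjective (CA ρ f) → SlideSurjective f
CA-surjective⇒slideSurjective {A} ρ f surj Y = X , slide≡Y
  where
  -- Y on the cells ρ, ρ + 1, …; the cells to the left of ρ are arbitrary.
  y : Config A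
  y i = Y ℤ.∣ i ℤ.- ℤ.+ ρ ∣

  x : Config A
  x = proj₁ (surj y)

  X : ℕ → A
  X n = x (ℤ.+ n)

  [ρ+t]-ρ≡t : ∀ t → ℤ.+ (ρ + t) ℤ.- ℤ.+ ρ ≡ ℤ.+ t
  [ρ+t]-ρ≡t t = trans (ℤP.[+m]-[+n]≡m⊖n (ρ + t) ρ) (trans (ℤP.≤-⊖ (m≤m+n ρ t)) (cong ℤ.+_ (m+n∸m≡n ρ t)))

  slide≡Y : ∀ t → slide f X t ≡ Y t
  slide≡Y t = begin
    slide f X t                ≡⟨ cong (λ i → f (tabulate (λ j → x (i ℤ.+ ℤ.+ toℕ j)))) ([ρ+t]-ρ≡t t) ⟨
    CA ρ f x (ℤ.+ (ρ + t))     ≡⟨ proj₂ (surj y) (ℤ.+ (ρ + t)) ⟩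
    y (ℤ.+ (ρ + t))            ≡⟨ cong (Y ∘ ℤ.∣_∣) ([ρ+t]-ρ≡t t) ⟩
    Y t                        ∎
    where open ≡-Reasoning

odd-^ : ∀ r d → ∃ λ s → suc (r * 2) ^ d ≡ suc (s * 2)
odd-^ r zero    = 0 , refl
odd-^ r (suc d) with odd-^ r d
... | s , e = s + r * suc (s * 2) , trans (cong (suc (r * 2) *_) e)
  (solve 2 (λ r s → (con 1 :+ r :* con 2) :* (con 1 :+ s :* con 2)
                  := con 1 :+ (s :+ r :* (con 1 :+ s :* con 2)) :* con 2) refl r s)

odd≢even : ∀ s t → suc (s * 2) ≢ t * 2
odd≢even s t e = even≢odd t s (trans (*-comm 2 t) (trans (sym e) (cong suc (*-comm s 2))))

even-or-odd : ∀ n → (∃ λ k → n ≡ k * 2) ⊎ (∃ λ k → n ≡ suc (k * 2))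
even-or-odd zero    = inj₁ (0 , refl)
even-or-odd (suc n) with even-or-odd n
... | inj₁ (k , n≡2k)   = inj₂ (k , cong suc n≡2k)
... | inj₂ (k , n≡2k+1) = inj₁ (suc k , cong suc n≡2k+1)

odd-prime : ∀ {p} → Prime p → p ≥ 3 → ∃ λ r → p ≡ suc (suc r * 2)
odd-prime {p} prime-p p≥3 with even-or-odd p
... | inj₁ (k , p≡2k)         = contradiction (composite p≥3 (divides k p≡2k)) (prime⇒¬composite prime-p)
... | inj₂ (zero , refl)      = contradiction p≥3 λ { (s≤s ()) }
... | inj₂ (suc r , p≡2r+3)   = r , p≡2r+3

mirror-invariant⇒¬surjective : ∀ r ρ (f : Vec (Fin (suc (r * 2))) (suc (ρ + ρ)) → Fin (suc (r * 2))) →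
  (∀ u → f (map mirror u) ≡ f u) → ∀ c → f (replicate _ zero) ≢ c → ¬ Surjective (CA ρ f)
mirror-invariant⇒¬surjective r ρ f f-mirror c f0≢c surj = <-irrefl refl (begin-strict
  k * q                       ≡⟨ sum-const k q ⟨
  ∑[ a < k ] q                <⟨ sum-mono-< c balanced (≤∧≢⇒< (balanced c) q≢N) ⟩
  ∑[ a < k ] fibreCount f a   ≡⟨ ∑-fibreCount f ⟩
  k * q                       ∎)
  where
  open ≤-Reasoning
  k q : ℕ
  k = suc (r * 2)
  q = k ^ (ρ + ρ)

  balanced : ∀ a → q ≤ fibreCount f a
  balanced a = slideSurjective⇒fibreCount≥ f a (CA-surjective⇒slideSurjective ρ f surj)

  q≢N : q ≢ fibreCount f c
  q≢N with odd-^ r (ρ + ρ) | ∑ⱽ-mirror-even r _ (λ u → δ (f u) c) (cong (λ b → δ b c) ∘ f-mirror)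
  ... | s , q≡2s+1 | t , N≡ = λ q≡N → odd≢even s t (begin-equality
    suc (s * 2)                        ≡⟨ q≡2s+1 ⟨
    q                                  ≡⟨ q≡N ⟩
    fibreCount f c                     ≡⟨ N≡ ⟩
    δ (f (replicate _ zero)) c + t * 2 ≡⟨ cong (_+ t * 2) (δ-≢ f0≢c) ⟩
    t * 2                              ∎)

corollary1 : (p : ℕ) .{{_ : NonZero p}} → Prime p → p ≥ 3 → (ρ : ℕ)
    → (f : Vec (ZMod.Zm p) (suc (ρ + ρ)) → ZMod.Zm p)
    → ZMod.IsQuadraticForm p f
    → ¬ Surjective (CA ρ f)
corollary1 p prime-p p≥3 ρ f quadratic with odd-prime prime-p p≥3
... | r , refl = mirror-invariant⇒¬surjective (suc r) ρ f (quadratic-mirror _ quadratic) (suc zero)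
                   (0≢1+n ∘ trans (sym (quadratic-zero _ quadratic)))
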